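{- Let $G=(V,E)$ be an infinite, connected, quasi-transitive, locally finite, simple graph and let $(h,\mathcal H)$ be a graph height function on $G$. Then $$0\le r(h,\mathcal H)\le (N-1)(2d+1)+2,$$ where $N$ is the number of orbits of $\mathcal H$ on $V$ and $d=d(h)$.
   Context: Fix an origin $\mathrm{id}\in V$. A graph height function is a pair $(h,\mathcal H)$ with $h:V\to\mathbb Z$, $h(\mathrm{id})=0$, $\mathcal H\le\mathrm{Aut}(G)$ acting quasi-transitively (finitely many orbits) with $h(\alpha v)-h(\alpha u)=h(v)-h(u)$ for all $\alpha\in\mathcal H$, $u,v\in V$, and every $v$ having neighbours $u,w$ with $h(u)<h(v)<h(w)$. $d(h)=\max\{|h(u)-h(v)|: u,v\in V,\ u\sim v\}$. A SAW is a walk visiting no vertex twice. $r(h,\mathcal H)=0$ if $\mathcal H$ acts transitively; otherwise $r(h,\mathcal H)$ is the least integer $r$ such that for any $u,v\in V$ in different $\mathcal H$-orbits there exist $u'\in\mathcal Hu$, $v'\in\mathcal Hv$ with $h(u')<h(v')$ and a SAW from $u'$ to $v'$ of length at most $r$, all of whose vertices $x$ other than its endpoints satisfy $h(u')<h(x)<h(v')$ (in particular the claim includes that such a finite $r$ exists). -}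

module Defs where

open import Data.Nat using (ℕ; _≤_; _+_)
open import Data.Integer as ℤ using (ℤ; ∣_∣) renaming (_<_ to _<ℤ_; _-_ to _-ℤ_)
open import Data.List using (List; []; _∷_; _++_; length)
open import Data.List.Membership.Propositional using (_∈_)
open import Data.List.Relation.Unary.All using (All)
open import Data.List.Relation.Unary.Linked using (Linked)
open import Data.List.Relation.Unary.Unique.Propositional using (Unique)
open import Data.Fin using (Fin)
open import Data.Product using (Σ; ∃; ∃-syntax; _×_; _,_)
open import Data.Sum using (_⊎_)
open import Function using (id; _∘_)
open import Relation.Binary.PropositionalEquality using (_≡_)
open import Relation.Nullary using (¬_)

module _ {V : Set} (_~_ : V → V → Set) where

  IsSimple : Set
  IsSimple = (∀ u v → u ~ v → v ~ u) × (∀ v → ¬ (v ~ v))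

  InfiniteVertices : Set
  InfiniteVertices = ¬ (Σ (List V) λ xs → ∀ v → v ∈ xs)

  LocallyFinite : Set
  LocallyFinite = ∀ v → Σ (List V) λ ns → ∀ u → (u ~ v → u ∈ ns) × (u ∈ ns → u ~ v)

  IsWalk : V → V → List V → Set
  IsWalk u v mid = Linked _~_ (u ∷ mid ++ v ∷ [])

  Connected : Set
  Connected = ∀ u v → u ≡ v ⊎ Σ (List V) λ mid → IsWalk u v mid

  IsAut : (V → V) → Set
  IsAut α = (Σ (V → V) λ β → (∀ x → β (α x) ≡ x) × (∀ x → α (β x) ≡ x))
          × (∀ u v → (u ~ v → α u ~ α v) × (α u ~ α v → u ~ v))

  QuasiTransitiveGraph : Set
  QuasiTransitiveGraph =
    Σ (List V) λ reps → ∀ v → Σ V λ w → w ∈ reps × Σ (V → V) λ α → IsAut α × α w ≡ v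

  record Subgroup : Set₁ where
    field
      Mem     : (V → V) → Set
      mem-aut : ∀ {α} → Mem α → IsAut α
      mem-id  : Mem id
      mem-∘   : ∀ {α β} → Mem α → Mem β → Mem (α ∘ β)
      mem-inv : ∀ {α} → Mem α →
                Σ (V → V) λ β → Mem β × (∀ x → β (α x) ≡ x) × (∀ x → α (β x) ≡ x)

  module _ (H : Subgroup) where
    open Subgroup H

    SameOrbit : V → V → Set
    SameOrbit u v = Σ (V → V) λ α → Mem α × α u ≡ v

    QuasiTransitive : Set
    QuasiTransitive = Σ (List V) λ reps → ∀ v → Σ V λ w → w ∈ reps × SameOrbit w v

    Transitive : Set
    Transitive = ∀ u v → SameOrbit u v

    NumOrbits : ℕ → Set
    NumOrbits N = Σ (Fin N → V) λ reps →
      (∀ i j → SameOrbit (reps i) (reps j) → i ≡ j) × (∀ v → ∃[ i ] SameOrbit (reps i) v)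

    IsHeightFunction : V → (V → ℤ) → Set
    IsHeightFunction o h =
      h o ≡ ℤ.0ℤ
      × QuasiTransitive
      × (∀ α → Mem α → ∀ u v → h (α v) -ℤ h (α u) ≡ h v -ℤ h u)
      × (∀ v → Σ V λ u → Σ V λ w → u ~ v × w ~ v × h u <ℤ h v × h v <ℤ h w)

    GoodSAW : (V → ℤ) → ℕ → V → V → Set
    GoodSAW h r u v = Σ (List V) λ mid →
      IsWalk u v mid × Unique (u ∷ mid ++ v ∷ [])
      × length mid + 1 ≤ r
      × All (λ x → h u <ℤ h x × h x <ℤ h v) mid

    RProp : (V → ℤ) → ℕ → Set
    RProp h r = ∀ u v → ¬ SameOrbit u v →
      Σ V λ u' → Σ V λ v' → SameOrbit u u' × SameOrbit v v' × h u' <ℤ h v' × GoodSAW h r u' v'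

    IsR : (V → ℤ) → ℕ → Set
    IsR h r = (Transitive × r ≡ 0)
            ⊎ (¬ Transitive × RProp h r × (∀ r' → RProp h r' → r ≤ r'))

  IsD : (V → ℤ) → ℕ → Set
  IsD h d = (∀ u v → u ~ v → ∣ h u -ℤ h v ∣ ≤ d)
          × Σ V λ u → Σ V λ v → u ~ v × ∣ h u -ℤ h v ∣ ≡ d

-- Let x and y represent distinct orbits and K = (N-1)d + 1. Climb K steps from x along a strictly ascending
-- ray, and descend K steps from y along a strictly descending ray down to some b. Join the top a of the first
-- ray to the orbit of b by a path meeting every orbit at most once: it has at most N-1 steps, so its heights
-- stay within (N-1)d < K of both of its ends. Translating the second ray to start at the end of that path
-- gives a good walk from x to the orbit of y, one whose interior lies strictly between its end heights, of
-- length at most 2K + N - 1 = (N-1)(2d+1) + 2. Cutting out a loop keeps a walk good, so a shortest good walk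
-- is self-avoiding.
--
-- Translating good walks shows that r(h,H) is the least r such that every pair of distinct orbit
-- representatives is joined by a good walk with fewer than r steps. Walks of given length from a vertex of a
-- locally finite graph can be enumerated, so this property is decidable and its least witness exists.
module Submission where

open import Defs
open import Data.Nat using (ℕ; zero; suc; z≤n; s≤s; _≤_; _<_; _+_; _*_; _∸_)
import Data.Nat.Properties as ℕ
open import Data.Nat.Induction using (<-rec)
open import Data.Fin using (Fin)
open import Data.Integer using (ℤ; +_; -[1+_]; ∣_∣; +≤+; -≤+; +<+)
  renaming (_<_ to _<ℤ_; _≤_ to _≤ℤ_; _+_ to _+ℤ_; _-_ to _-ℤ_)
import Data.Integer.Properties as ℤ
open import Data.Integer.Solver using (module +-*-Solver)
import Data.Nat.Solver as ℕ-Solver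
import Data.Fin.Properties as Fin
open import Data.List using (List; []; _∷_; _++_; length; lookup; map)
open import Data.List.Membership.Propositional using (_∈_; find; lose)
open import Data.List.Relation.Unary.Any as Any using (Any; here; there)
open import Data.List.Membership.Propositional.Properties using (∈-lookup; ∈-∃++)
open import Data.List.Relation.Unary.All as All using (All; []; _∷_)
import Data.List.Relation.Unary.All.Properties as All
open import Data.List.Relation.Unary.Linked using ([-]; _∷_)
open import Data.List.Relation.Unary.Unique.Propositional using (Unique)
open import Data.List.Relation.Unary.AllPairs using ([]; _∷_)
import Data.List.Relation.Unary.AllPairs.Properties as AllPairs
import Data.List.Properties as List
open import Data.Product using (Σ; ∃; _×_; _,_; proj₁; proj₂)
open import Data.Sum using (inj₁; inj₂)
open import Data.Empty using (⊥-elim)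
open import Function using (id; _∘_; case_of_)
open import Function.Definitions using (Injective)
open import Relation.Binary.PropositionalEquality
open import Relation.Nullary using (¬_; Dec; yes; no)
open import Relation.Nullary.Decidable using (map′; _×-dec_; ¬?; _→-dec_)
open import Relation.Unary using (Decidable)
open import Relation.Binary.Construct.Closure.ReflexiveTransitive as Star using (Star; ε; _◅_; _◅◅_; gmap)

module _ {P : ℕ → Set} (P? : Decidable P) where

  least : ∀ {n} → P n → ∃ λ m → m ≤ n × P m × (∀ {k} → k < m → ¬ P k)
  least {n} = <-rec Goal search n
    where
      Goal : ℕ → Set
      Goal n = P n → ∃ λ m → m ≤ n × P m × (∀ {k} → k < m → ¬ P k)

      search : ∀ n → (∀ {k} → k < n → Goal k) → Goal n
      search n rec Pn with ℕ.anyUpTo? P? n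
      ... | no none = n , ℕ.≤-refl , Pn , λ k<n Pk → none (_ , k<n , Pk)
      ... | yes (k , k<n , Pk) with rec k<n Pk
      ...   | m , m≤k , Pm , minimal = m , ℕ.≤-trans m≤k (ℕ.<⇒≤ k<n) , Pm , minimal

module _ {A : Set} where

  lookup-injective : {xs : List A} → Unique xs → Injective _≡_ _≡_ (lookup xs)
  lookup-injective {_ ∷ _} _ {Fin.zero} {Fin.zero} _ = refl
  lookup-injective {_ ∷ _} (x∉ ∷ _) {Fin.zero} {Fin.suc j} eq = ⊥-elim (All.lookup x∉ (∈-lookup j) eq)
  lookup-injective {_ ∷ _} (x∉ ∷ _) {Fin.suc i} {Fin.zero} eq = ⊥-elim (All.lookup x∉ (∈-lookup i) (sym eq))
  lookup-injective {_ ∷ _} (_ ∷ u) {Fin.suc i} {Fin.suc j} eq = cong Fin.suc (lookup-injective u eq)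

  no-repetition⇒Unique : ∀ xs → (∀ as (z : A) bs cs → xs ≢ as ++ z ∷ bs ++ z ∷ cs) → Unique xs
  no-repetition⇒Unique [] _ = []
  no-repetition⇒Unique (x ∷ xs) norep =
    All.tabulate x≢ ∷ no-repetition⇒Unique xs (λ as z bs cs → norep (x ∷ as) z bs cs ∘ cong (x ∷_))
    where
      x≢ : ∀ {y : A} → y ∈ xs → x ≢ y
      x≢ y∈xs refl with bs , cs , eq ← ∈-∃++ y∈xs = norep [] x bs cs (cong (x ∷_) eq)

  All-drop-segment : ∀ {P : A → Set} as ys {zs} → All P (as ++ ys ++ zs) → All P (as ++ zs)
  All-drop-segment as ys all =
    All.++⁺ (All.++⁻ˡ as all) (All.++⁻ʳ ys (All.++⁻ʳ as all))

  length-drop-segment : ∀ as (y : A) ys zs → length (as ++ zs) < length (as ++ y ∷ ys ++ zs)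
  length-drop-segment [] y ys zs = s≤s (subst (length zs ≤_) (sym (List.length-++ ys)) (ℕ.m≤n+m _ _))
  length-drop-segment (a ∷ as) y ys zs = s≤s (length-drop-segment as y ys zs)

Unique⇒length≤ : ∀ {n} {xs : List (Fin n)} → Unique xs → length xs ≤ n
Unique⇒length≤ u = Fin.injective⇒≤ (lookup-injective u)

module _ where
  open +-*-Solver

  i≡j+[i-j] : ∀ i j → i ≡ j +ℤ (i -ℤ j)
  i≡j+[i-j] = solve 2 (λ i j → i := j :+ (i :- j)) refl

  i+[j-k]≡j+[i-k] : ∀ i j k → i +ℤ (j -ℤ k) ≡ j +ℤ (i -ℤ k)
  i+[j-k]≡j+[i-k] = solve 3 (λ i j k → i :+ (j :- k) := j :+ (i :- k)) refl

i≤+∣i∣ : ∀ i → i ≤ℤ + ∣ i ∣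
i≤+∣i∣ (+ n) = ℤ.≤-refl
i≤+∣i∣ -[1+ n ] = -≤+

i≤j+∣i-j∣ : ∀ i j → i ≤ℤ j +ℤ + ∣ i -ℤ j ∣
i≤j+∣i-j∣ i j =
  subst (_≤ℤ j +ℤ + ∣ i -ℤ j ∣) (sym (i≡j+[i-j] i j)) (ℤ.+-monoʳ-≤ j (i≤+∣i∣ (i -ℤ j)))

module _ {i j : ℤ} where
  open ℤ.≤-Reasoning

  +-offset-mono : ∀ {m n} → i ≤ℤ j +ℤ + m → m ≤ n → i ≤ℤ j +ℤ + n
  +-offset-mono i≤ m≤n = ℤ.≤-trans i≤ (ℤ.+-monoʳ-≤ j (+≤+ m≤n))

  +-offset-trans : ∀ {k} m n → i ≤ℤ j +ℤ + m → j ≤ℤ k +ℤ + n → i ≤ℤ k +ℤ + (m + n)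
  +-offset-trans {k} m n i≤ j≤ = begin
    i                  ≤⟨ i≤ ⟩
    j +ℤ + m           ≤⟨ ℤ.+-monoˡ-≤ (+ m) j≤ ⟩
    (k +ℤ + n) +ℤ + m  ≡⟨ ℤ.+-assoc k (+ n) (+ m) ⟩
    k +ℤ + (n + m)     ≡⟨ cong (λ l → k +ℤ + l) (ℕ.+-comm n m) ⟩
    k +ℤ + (m + n)     ∎

  <-+-offset-suc : ∀ {k} n → i <ℤ j → j +ℤ + n ≤ℤ k → i +ℤ + suc n ≤ℤ k
  <-+-offset-suc {k} n i<j j+n≤k = begin
    i +ℤ + suc n       ≡⟨ ℤ.+-assoc i (+ 1) (+ n) ⟨
    (i +ℤ + 1) +ℤ + n  ≡⟨ cong (_+ℤ + n) (ℤ.+-comm i (+ 1)) ⟩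
    (+ 1 +ℤ i) +ℤ + n  ≤⟨ ℤ.+-monoˡ-≤ (+ n) (ℤ.i<j⇒suc[i]≤j i<j) ⟩
    j +ℤ + n           ≤⟨ j+n≤k ⟩
    k                  ∎

  ≤-+-offset-< : ∀ {k m n} → i ≤ℤ j +ℤ + m → m < n → j +ℤ + n ≤ℤ k → i <ℤ k
  ≤-+-offset-< {k} {m} {n} i≤ m<n j+n≤k = begin-strict
    i         ≤⟨ i≤ ⟩
    j +ℤ + m  <⟨ ℤ.+-monoʳ-< j (+<+ m<n) ⟩
    j +ℤ + n  ≤⟨ j+n≤k ⟩
    k         ∎

  +-offset-cancel-< : ∀ {m n} → m < n → i +ℤ + n ≤ℤ j +ℤ + m → i <ℤ j
  +-offset-cancel-< {m} {n} m<n i+n≤j+m with i ℤ.<? j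
  ... | yes i<j = i<j
  ... | no i≮j = ⊥-elim (ℤ.<-irrefl refl (begin-strict
    j +ℤ + m  ≤⟨ ℤ.+-monoˡ-≤ (+ m) (ℤ.≮⇒≥ i≮j) ⟩
    i +ℤ + m  <⟨ ℤ.+-monoʳ-< i (+<+ m<n) ⟩
    i +ℤ + n  ≤⟨ i+n≤j+m ⟩
    j +ℤ + m  ∎))

module _ {V : Set} {R : V → V → Set} where

  IsWalk-map : ∀ {f : V → V} → (∀ {x y} → R x y → R (f x) (f y)) →
               ∀ {u v} mid → IsWalk R u v mid → IsWalk R (f u) (f v) (map f mid)
  IsWalk-map f-hom [] (e ∷ [-]) = f-hom e ∷ [-]
  IsWalk-map f-hom (_ ∷ mid) (e ∷ w) = f-hom e ∷ IsWalk-map f-hom mid w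

  IsWalk-drop : ∀ bs {x v z cs} → IsWalk R x v (bs ++ z ∷ cs) → IsWalk R z v cs
  IsWalk-drop [] (_ ∷ w) = w
  IsWalk-drop (_ ∷ bs) (_ ∷ w) = IsWalk-drop bs w

  IsWalk-shortcut : ∀ as {u v z} bs {cs} → IsWalk R u v (as ++ z ∷ bs ++ z ∷ cs) → IsWalk R u v (as ++ z ∷ cs)
  IsWalk-shortcut [] bs (e ∷ w) = e ∷ IsWalk-drop bs w
  IsWalk-shortcut (_ ∷ as) bs (e ∷ w) = e ∷ IsWalk-shortcut as bs w

  length⋆ : ∀ {x z} → Star R x z → ℕ
  length⋆ ε = 0
  length⋆ (_ ◅ p) = suc (length⋆ p)

  after : ∀ {x z} → Star R x z → List V
  after ε = []
  after (_◅_ {j = y} _ p) = y ∷ after p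

  before : ∀ {x z} → Star R x z → List V
  before ε = []
  before (_◅_ {i = x} _ p) = x ∷ before p

  vertices : ∀ {x z} → Star R x z → List V
  vertices {x} p = x ∷ after p

  length-before : ∀ {x z} (p : Star R x z) → length (before p) ≡ length⋆ p
  length-before ε = refl
  length-before (_ ◅ p) = cong suc (length-before p)

  length-vertices : ∀ {x z} (p : Star R x z) → length (vertices p) ≡ suc (length⋆ p)
  length-vertices ε = refl
  length-vertices (_ ◅ p) = cong suc (length-vertices p)

  length⋆-◅◅ : ∀ {x y z} (p : Star R x y) (q : Star R y z) → length⋆ (p ◅◅ q) ≡ length⋆ p + length⋆ q
  length⋆-◅◅ ε q = refl
  length⋆-◅◅ (_ ◅ p) q = cong suc (length⋆-◅◅ p q)

  after-◅◅ : ∀ {x y z} (p : Star R x y) (q : Star R y z) → after (p ◅◅ q) ≡ after p ++ after q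
  after-◅◅ ε q = refl
  after-◅◅ (_ ◅ p) q = cong (_ ∷_) (after-◅◅ p q)

  before-◅◅ : ∀ {x y z} (p : Star R x y) (q : Star R y z) → before (p ◅◅ q) ≡ before p ++ before q
  before-◅◅ ε q = refl
  before-◅◅ (_ ◅ p) q = cong (_ ∷_) (before-◅◅ p q)

  before-∷ʳ : ∀ {x z} (p : Star R x z) → before p ++ z ∷ [] ≡ vertices p
  before-∷ʳ ε = refl
  before-∷ʳ (_ ◅ p) = cong (_ ∷_) (before-∷ʳ p)

  interior : ∀ {x z} → Star R x z → List V
  interior ε = []
  interior (_ ◅ p) = before p

  length-interior : ∀ {x z} (p : Star R x z) → 0 < length⋆ p → suc (length (interior p)) ≡ length⋆ p
  length-interior (_ ◅ p) _ = cong suc (length-before p)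

  All-before : ∀ {P : V → Set} {x z} (p : Star R x z) → All P (vertices p) → All P (before p)
  All-before p all = All.++⁻ˡ (before p) (subst (All _) (sym (before-∷ʳ p)) all)

  All-end : ∀ {P : V → Set} {x z} (p : Star R x z) → All P (vertices p) → P z
  All-end p all with Pz ∷ [] ← All.++⁻ʳ (before p) (subst (All _) (sym (before-∷ʳ p)) all) = Pz

  split-at : ∀ {x z w} (p : Star R x z) → w ∈ vertices p →
             Σ (Star R x w) λ p₁ → Σ (Star R w z) λ p₂ → length⋆ p₁ + length⋆ p₂ ≡ length⋆ p
  split-at p (here refl) = ε , p , refl
  split-at (e ◅ p) (there w∈) with p₁ , p₂ , eq ← split-at p w∈ = e ◅ p₁ , p₂ , cong suc eq

  walk⇒path : ∀ {x v} mid → IsWalk R x v mid → Star R x v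
  walk⇒path [] (e ∷ [-]) = e ◅ ε
  walk⇒path (_ ∷ mid) (e ∷ w) = e ◅ walk⇒path mid w

  connected⇒path : Connected R → ∀ a b → Star R a b
  connected⇒path connected a b with connected a b
  ... | inj₁ refl = ε
  ... | inj₂ (mid , w) = walk⇒path mid w

  path⇒walk : ∀ {x y z} → R x y → (p : Star R y z) → IsWalk R x z (before p)
  path⇒walk e ε = e ∷ [-]
  path⇒walk e (e′ ◅ p) = e ∷ path⇒walk e′ p

length⋆-gmap : ∀ {V W : Set} {R : V → V → Set} {S : W → W → Set} (f : V → W)
               (g : ∀ {x y} → R x y → S (f x) (f y)) {x z} (p : Star R x z) →
               length⋆ (gmap {U = S} f g p) ≡ length⋆ p
length⋆-gmap f g ε = refl
length⋆-gmap f g (_ ◅ p) = cong suc (length⋆-gmap f g p)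

module _ {V : Set} (_~_ : V → V → Set) where

  WalkWith : (List V → V → Set) → ℕ → V → Set
  WalkWith P n x = Σ (List V) λ mid → Σ V λ v → IsWalk _~_ x v mid × length mid ≡ n × P mid v

  module _ (~-sym : ∀ u v → u ~ v → v ~ u) (locally-finite : LocallyFinite _~_) where

    any-neighbour? : ∀ {P : V → Set} → Decidable P → ∀ x → Dec (Σ V λ y → x ~ y × P y)
    any-neighbour? {P} P? x = map′ found lose′ (Any.any? P? neighbours)
      where
        neighbours = proj₁ (locally-finite x)
        found : Any P neighbours → Σ V λ y → x ~ y × P y
        found any with y , y∈ , Py ← find any = y , ~-sym y x (proj₂ (proj₂ (locally-finite x) y) y∈) , Py
        lose′ : (Σ V λ y → x ~ y × P y) → Any P neighbours
        lose′ (y , x~y , Py) = lose (proj₁ (proj₂ (locally-finite x) y) (~-sym x y x~y)) Py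

    any-walk? : ∀ n {P : List V → V → Set} → (∀ mid v → Dec (P mid v)) → ∀ x → Dec (WalkWith P n x)
    any-walk? zero {P} P? x = map′ one-step from-one-step (any-neighbour? (P? []) x)
      where
        one-step : (Σ V λ y → x ~ y × P [] y) → WalkWith P 0 x
        one-step (y , x~y , Py) = [] , y , x~y ∷ [-] , refl , Py
        from-one-step : WalkWith P 0 x → Σ V λ y → x ~ y × P [] y
        from-one-step ([] , y , x~y ∷ [-] , refl , Py) = y , x~y , Py
    any-walk? (suc n) {P} P? x =
      map′ extend restrict (any-neighbour? (λ y → any-walk? n (λ mid → P? (y ∷ mid)) y) x)
      where
        extend : (Σ V λ y → x ~ y × WalkWith (P ∘ (y ∷_)) n y) → WalkWith P (suc n) x
        extend (y , x~y , mid , v , w , refl , Pw) = y ∷ mid , v , x~y ∷ w , refl , Pw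
        restrict : WalkWith P (suc n) x → Σ V λ y → x ~ y × WalkWith (P ∘ (y ∷_)) n y
        restrict (y ∷ mid , v , x~y ∷ w , refl , Pw) = y , x~y , mid , v , w , refl , Pw

module _ {V : Set} {_~_ : V → V → Set} (H : Subgroup _~_) where
  open Subgroup H

  orbit-refl : ∀ x → SameOrbit _~_ H x x
  orbit-refl x = id , mem-id , refl

  orbit-sym : ∀ {x y} → SameOrbit _~_ H x y → SameOrbit _~_ H y x
  orbit-sym {x} (α , α∈H , refl) with β , β∈H , βα , _ ← mem-inv α∈H = β , β∈H , βα x

  orbit-trans : ∀ {x y z} → SameOrbit _~_ H x y → SameOrbit _~_ H y z → SameOrbit _~_ H x z
  orbit-trans (α , α∈H , refl) (β , β∈H , refl) = β ∘ α , mem-∘ β∈H α∈H , refl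

  edge-invariant : ∀ {α} → Mem α → ∀ {u v} → u ~ v → α u ~ α v
  edge-invariant α∈H {u} {v} = proj₁ (proj₂ (mem-aut α∈H) u v)

  module Orbits {N : ℕ} (rep : Fin N → V)
           (rep-injective : ∀ i j → SameOrbit _~_ H (rep i) (rep j) → i ≡ j)
           (rep-covers : ∀ v → ∃ λ i → SameOrbit _~_ H (rep i) v) where

    open import Data.List.Membership.DecPropositional (Fin._≟_ {N}) using (_∈?_)

    orb : V → Fin N
    orb v = proj₁ (rep-covers v)

    orb-rep : ∀ v → SameOrbit _~_ H (rep (orb v)) v
    orb-rep v = proj₂ (rep-covers v)

    orb-cong : ∀ {x y} → SameOrbit _~_ H x y → orb x ≡ orb y
    orb-cong {x} {y} x≈y = rep-injective _ _ (orbit-trans (orb-rep x) (orbit-trans x≈y (orbit-sym (orb-rep y))))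

    orb-complete : ∀ {x y} → orb x ≡ orb y → SameOrbit _~_ H x y
    orb-complete {x} {y} eq =
      orbit-trans (orbit-sym (orb-rep x)) (subst (λ i → SameOrbit _~_ H (rep i) y) (sym eq) (orb-rep y))

    same-orbit? : ∀ x y → Dec (SameOrbit _~_ H x y)
    same-orbit? x y = map′ orb-complete orb-cong (orb x Fin.≟ orb y)

    transitive? : Dec (Transitive _~_ H)
    transitive? = map′ (λ all-equal u v → orb-complete (all-equal (orb u) (orb v)))
                       (λ transitive i j → rep-injective i j (transitive (rep i) (rep j)))
                       (Fin.all? λ i → Fin.all? λ j → i Fin.≟ j)

    orbits : ∀ {R : V → V → Set} {x z} → Star R x z → List (Fin N)
    orbits p = map orb (vertices p)

    relocate : ∀ {R : V → V → Set} → (∀ {α} → Mem α → ∀ {u v} → R u v → R (α u) (α v)) →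
               ∀ {a a′ b} → SameOrbit _~_ H a a′ → (p : Star R a b) →
               Σ V λ b′ → SameOrbit _~_ H b b′ ×
                 Σ (Star R a′ b′) λ q → length⋆ q ≡ length⋆ p × orbits q ≡ orbits p
    relocate {R} R-invariant {b = b} (α , α∈H , refl) p =
        α b , (α , α∈H , refl) , gmap α (R-invariant α∈H) p
      , length⋆-gmap α (R-invariant α∈H) p , orbits-gmap p
      where
        orb-α : ∀ x → orb (α x) ≡ orb x
        orb-α x = sym (orb-cong (α , α∈H , refl))
        orbits-gmap : ∀ {x z} (p : Star R x z) → orbits (gmap α (R-invariant α∈H) p) ≡ orbits p
        orbits-gmap ε = cong (_∷ []) (orb-α _)
        orbits-gmap (_ ◅ p) = cong₂ _∷_ (orb-α _) (orbits-gmap p)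

    suffix-from : ∀ {i a b} (p : Star _~_ a b) → i ∈ orbits p → Unique (orbits p) →
                  Σ V λ z → orb z ≡ i × Σ (Star _~_ z b) λ s → Unique (orbits s)
    suffix-from p (here i≡) u = _ , sym i≡ , p , u
    suffix-from (_ ◅ p) (there i∈) (_ ∷ u) = suffix-from p i∈ u

    -- If the orbit of a occurs again on q, translate the suffix of q starting there so that it starts at a.
    orbit-injective-path : ∀ {a b} → Star _~_ a b →
                           Σ V λ b′ → SameOrbit _~_ H b b′ × Σ (Star _~_ a b′) λ q → Unique (orbits q)
    orbit-injective-path ε = _ , orbit-refl _ , ε , [] ∷ []
    orbit-injective-path {a} (e ◅ p) with b′ , b≈b′ , q , unique-q ← orbit-injective-path p | orb a ∈? orbits q
    ... | no a∉q = b′ , b≈b′ , e ◅ q , All.¬Any⇒All¬ _ a∉q ∷ unique-q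
    ... | yes a∈q with z , z≡a , s , unique-s ← suffix-from q a∈q unique-q
                  with b″ , b′≈b″ , s′ , _ , orbits-s′ ← relocate edge-invariant (orb-complete z≡a) s =
      b″ , orbit-trans b≈b′ b′≈b″ , s′ , subst Unique (sym orbits-s′) unique-s

    orbit-distance : Connected _~_ → ∀ a b →
                     Σ V λ b′ → SameOrbit _~_ H b b′ × Σ (Star _~_ a b′) λ q → length⋆ q ≤ N ∸ 1
    orbit-distance connected a b
      with b′ , b≈b′ , q , unique-q ← orbit-injective-path (connected⇒path connected a b) =
      b′ , b≈b′ , q , ℕ.∸-monoˡ-≤ 1 (subst (_≤ N) length-orbits (Unique⇒length≤ unique-q))
      where
        length-orbits : length (orbits q) ≡ suc (length⋆ q)
        length-orbits = trans (List.length-map orb (vertices q)) (length-vertices q)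

  module Heights (h : V → ℤ)
                 (h-invariant : ∀ α → Mem α → ∀ u v → h (α v) -ℤ h (α u) ≡ h v -ℤ h u) where

    translate-< : ∀ {α} → Mem α → ∀ {u v} → h u <ℤ h v → h (α u) <ℤ h (α v)
    translate-< {α} α∈H {u} {v} u<v =
      subst₂ _<ℤ_ (sym (i≡j+[i-j] (h (α u)) (h u))) (sym shift) (ℤ.+-monoˡ-< (h (α u) -ℤ h u) u<v)
      where
        open ≡-Reasoning
        shift : h (α v) ≡ h v +ℤ (h (α u) -ℤ h u)
        shift = begin
          h (α v)                        ≡⟨ i≡j+[i-j] (h (α v)) (h (α u)) ⟩
          h (α u) +ℤ (h (α v) -ℤ h (α u)) ≡⟨ cong (h (α u) +ℤ_) (h-invariant α α∈H u v) ⟩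
          h (α u) +ℤ (h v -ℤ h u)         ≡⟨ i+[j-k]≡j+[i-k] (h (α u)) (h v) (h u) ⟩
          h v +ℤ (h (α u) -ℤ h u)         ∎

    height-<⇒≢ : ∀ {x y} → h x <ℤ h y → x ≢ y
    height-<⇒≢ hx<hy refl = ℤ.<-irrefl refl hx<hy

    Up : V → V → Set
    Up u v = u ~ v × h u <ℤ h v

    Up-invariant : ∀ {α} → Mem α → ∀ {u v} → Up u v → Up (α u) (α v)
    Up-invariant α∈H (u~v , u<v) = edge-invariant α∈H u~v , translate-< α∈H u<v

    Between : V → V → V → Set
    Between u v x = h u <ℤ h x × h x <ℤ h v

    Rising : V → V → List V → Set
    Rising u v mid = h u <ℤ h v × All (Between u v) mid

    rising? : ∀ u v mid → Dec (Rising u v mid)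
    rising? u v mid = h u ℤ.<? h v ×-dec All.all? (λ x → h u ℤ.<? h x ×-dec h x ℤ.<? h v) mid

    GoodWalk : V → V → List V → Set
    GoodWalk u v mid = IsWalk _~_ u v mid × Rising u v mid

    GoodWalk-relocate : ∀ {u u′ v mid} → SameOrbit _~_ H u u′ → GoodWalk u v mid →
                        Σ V λ v′ → SameOrbit _~_ H v v′ ×
                          Σ (List V) λ mid′ → GoodWalk u′ v′ mid′ × length mid′ ≡ length mid
    GoodWalk-relocate {v = v} {mid} (α , α∈H , refl) (walk , u<v , between) =
        α v , (α , α∈H , refl) , map α mid
      , (IsWalk-map (edge-invariant α∈H) mid walk , translate-< α∈H u<v
      , All.map⁺ (All.map (λ (u<x , x<v) → translate-< α∈H u<x , translate-< α∈H x<v) between))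
      , List.length-map α mid

    GoodWalk-shortcut : ∀ as {u v z} bs {cs} → GoodWalk u v (as ++ z ∷ bs ++ z ∷ cs) →
                        GoodWalk u v (as ++ z ∷ cs)
    GoodWalk-shortcut as bs (walk , u<v , between) =
      IsWalk-shortcut as bs walk , u<v , All-drop-segment as (_ ∷ bs) between

    shortest-GoodWalk-Unique : ∀ {u v mid} → GoodWalk u v mid →
                               (∀ {mid′} → GoodWalk u v mid′ → ¬ length mid′ < length mid) →
                               Unique (u ∷ mid ++ v ∷ [])
    shortest-GoodWalk-Unique {u} {v} {mid} good@(_ , u<v , between) shortest =
        All.++⁺ (All.map (height-<⇒≢ ∘ proj₁) between) (height-<⇒≢ u<v ∷ [])
      ∷ AllPairs.++⁺ (no-repetition⇒Unique mid no-repetition) ([] ∷ [])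
                     (All.map (λ (_ , x<v) → height-<⇒≢ x<v ∷ []) between)
      where
        no-repetition : ∀ as z bs cs → mid ≢ as ++ z ∷ bs ++ z ∷ cs
        no-repetition as z bs cs mid≡ =
          shortest (GoodWalk-shortcut as bs (subst (GoodWalk u v) mid≡ good))
                   (subst (λ l → length (as ++ z ∷ cs) < length l) (sym mid≡)
                          (length-drop-segment as z bs (z ∷ cs)))

    Above : ℤ → ∀ {x z} → Star _~_ x z → Set
    Above c p = All (λ w → c <ℤ h w) (after p)

    Below : ℤ → ∀ {x z} → Star _~_ x z → Set
    Below c p = All (λ w → h w <ℤ c) (before p)

    Above-◅◅ : ∀ {c x y z} (p : Star _~_ x y) (q : Star _~_ y z) → Above c p → Above c q → Above c (p ◅◅ q)
    Above-◅◅ p q above-p above-q = subst (All _) (sym (after-◅◅ p q)) (All.++⁺ above-p above-q)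

    Below-◅◅ : ∀ {c x y z} (p : Star _~_ x y) (q : Star _~_ y z) → Below c p → Below c q → Below c (p ◅◅ q)
    Below-◅◅ p q below-p below-q = subst (All _) (sym (before-◅◅ p q)) (All.++⁺ below-p below-q)

    path⇒GoodWalk : ∀ {x z} (p : Star _~_ x z) → 0 < length⋆ p → Above (h x) p → Below (h z) p →
                    GoodWalk x z (interior p)
    path⇒GoodWalk (e ◅ p) _ above (_ ∷ below) =
      path⇒walk e p , All-end p above , All.zip (All-before p above , below)

    ascending-rise : ∀ {a b} (p : Star Up a b) → h a +ℤ + length⋆ p ≤ℤ h b
    ascending-rise ε = ℤ.≤-reflexive (ℤ.+-identityʳ _)
    ascending-rise ((_ , a<y) ◅ p) = <-+-offset-suc (length⋆ p) a<y (ascending-rise p)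

    ascending-≤ : ∀ {a b} (p : Star Up a b) → h a ≤ℤ h b
    ascending-≤ {a} p = ℤ.≤-trans (ℤ.i≤i+j (h a) (+ length⋆ p)) (ascending-rise p)

    ascending-above : ∀ {a b} (p : Star Up a b) → Above (h a) (Star.map proj₁ p)
    ascending-above ε = []
    ascending-above ((_ , a<y) ◅ p) = a<y ∷ All.map (ℤ.<-trans a<y) (ascending-above p)

    ascending-below : ∀ {a b} (p : Star Up a b) → Below (h b) (Star.map proj₁ p)
    ascending-below ε = []
    ascending-below ((_ , a<y) ◅ p) = ℤ.<-≤-trans a<y (ascending-≤ p) ∷ ascending-below p

    module Rays (~-sym : ∀ u v → u ~ v → v ~ u)
                (h-unbounded : ∀ v → Σ V λ u → Σ V λ w → u ~ v × w ~ v × h u <ℤ h v × h v <ℤ h w) where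

      ascending-from : ∀ n x → Σ V λ z → Σ (Star Up x z) λ p → length⋆ p ≡ n
      ascending-from zero x = x , ε , refl
      ascending-from (suc n) x
        with _ , w , _ , w~x , _ , x<w ← h-unbounded x
        with z , p , refl ← ascending-from n w = z , (~-sym w x w~x , x<w) ◅ p , refl

      ascending-into : ∀ n v → Σ V λ y → Σ (Star Up y v) λ p → length⋆ p ≡ n
      ascending-into zero v = v , ε , refl
      ascending-into (suc n) v
        with u , _ , u~v , _ , u<v , _ ← h-unbounded v
        with y , p , refl ← ascending-into n u =
          y , p ◅◅ ((u~v , u<v) ◅ ε) , trans (length⋆-◅◅ p _) (ℕ.+-comm (length⋆ p) 1)

    module Drift (d : ℕ) (h-lipschitz : ∀ u v → u ~ v → ∣ h u -ℤ h v ∣ ≤ d) where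

      drift : ∀ {a b} (p : Star _~_ a b) → h a ≤ℤ h b +ℤ + (length⋆ p * d)
      drift {a} ε = ℤ.i≤i+j (h a) (+ 0)
      drift {a} {b} (_◅_ {j = y} a~y p) =
        +-offset-trans {j = h y} {k = h b} d (length⋆ p * d)
          (+-offset-mono {j = h y} (i≤j+∣i-j∣ (h a) (h y)) (h-lipschitz a y a~y)) (drift p)

      drift-through : ∀ {a b w} (p : Star _~_ a b) → w ∈ vertices p →
                      h a ≤ℤ h w +ℤ + (length⋆ p * d) × h w ≤ℤ h b +ℤ + (length⋆ p * d)
      drift-through {b = b} {w} p w∈p with p₁ , p₂ , length-p ← split-at p w∈p =
          +-offset-mono {j = h w} (drift p₁) (ℕ.*-monoˡ-≤ d (subst (length⋆ p₁ ≤_) length-p (ℕ.m≤m+n _ _)))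
        , +-offset-mono {j = h b} (drift p₂) (ℕ.*-monoˡ-≤ d (subst (length⋆ p₂ ≤_) length-p (ℕ.m≤n+m _ _)))

  module Bound (~-sym : ∀ u v → u ~ v → v ~ u) (locally-finite : LocallyFinite _~_) (connected : Connected _~_)
               {N : ℕ} (rep : Fin N → V)
               (rep-injective : ∀ i j → SameOrbit _~_ H (rep i) (rep j) → i ≡ j)
               (rep-covers : ∀ v → ∃ λ i → SameOrbit _~_ H (rep i) v)
               (h : V → ℤ) (h-invariant : ∀ α → Mem α → ∀ u v → h (α v) -ℤ h (α u) ≡ h v -ℤ h u)
               (h-unbounded : ∀ v → Σ V λ u → Σ V λ w → u ~ v × w ~ v × h u <ℤ h v × h v <ℤ h w)
               (d : ℕ) (h-lipschitz : ∀ u v → u ~ v → ∣ h u -ℤ h v ∣ ≤ d) where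
    open Orbits rep rep-injective rep-covers
    open Heights h h-invariant
    open Rays ~-sym h-unbounded
    open Drift d h-lipschitz

    GoodWalk-glue : ∀ {x a t v} (up : Star Up x a) (τ : Star _~_ a t) (down : Star Up t v) →
                    length⋆ τ * d < length⋆ up → length⋆ τ * d < length⋆ down →
                    Σ (List V) λ mid → GoodWalk x v mid ×
                                       suc (length mid) ≡ length⋆ up + (length⋆ τ + length⋆ down)
    GoodWalk-glue {x} {a} {t} {v} up@(_ ◅ _) τ down τ<up τ<down =
      interior up-τ-down , path⇒GoodWalk up-τ-down (s≤s z≤n) above below , length-up-τ-down
      where
        up′ = Star.map proj₁ up
        down′ = Star.map proj₁ down
        up-τ-down = up′ ◅◅ τ ◅◅ down′

        τ-between : All (Between x v) (vertices τ)
        τ-between = All.tabulate λ w∈τ →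
            +-offset-cancel-< τ<up (ℤ.≤-trans (ascending-rise up) (proj₁ (drift-through τ w∈τ)))
          , ≤-+-offset-< {j = h t} (proj₂ (drift-through τ w∈τ)) τ<down (ascending-rise down)

        above : Above (h x) up-τ-down
        above = Above-◅◅ up′ _ (ascending-above up) (Above-◅◅ τ down′
          (All.map proj₁ (All.tail τ-between))
          (All.map (ℤ.<-trans (proj₁ (All-end τ τ-between))) (ascending-above down)))

        below : Below (h v) up-τ-down
        below = Below-◅◅ up′ _
          (All.map (λ w<a → ℤ.<-trans w<a (proj₂ (All.head τ-between))) (ascending-below up))
          (Below-◅◅ τ down′ (All.map proj₂ (All-before τ τ-between)) (ascending-below down))

        length-up-τ-down : suc (length (interior up-τ-down)) ≡ length⋆ up + (length⋆ τ + length⋆ down)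
        length-up-τ-down = begin
          suc (length (interior up-τ-down))        ≡⟨ length-interior up-τ-down (s≤s z≤n) ⟩
          length⋆ up-τ-down                        ≡⟨ length⋆-◅◅ up′ _ ⟩
          length⋆ up′ + length⋆ (τ ◅◅ down′)       ≡⟨ cong (λ n → length⋆ up′ + n) (length⋆-◅◅ τ down′) ⟩
          length⋆ up′ + (length⋆ τ + length⋆ down′) ≡⟨ cong₂ (λ m n → m + (length⋆ τ + n))
                                                              (length⋆-gmap id proj₁ up) (length⋆-gmap id proj₁ down) ⟩
          length⋆ up + (length⋆ τ + length⋆ down)  ∎
          where open ≡-Reasoning

    ray-length : ℕ
    ray-length = suc ((N ∸ 1) * d)

    bound : ℕ
    bound = (N ∸ 1) * (2 * d + 1) + 2

    link<ray : ∀ {k m} → k ≤ N ∸ 1 → m ≡ ray-length → k * d < m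
    link<ray k≤ refl = s≤s (ℕ.*-monoˡ-≤ d k≤)

    rays-and-link≤bound : ∀ {k m n} → k ≤ N ∸ 1 → m ≡ ray-length → n ≡ ray-length → m + (k + n) ≤ bound
    rays-and-link≤bound {k} k≤ refl refl = begin
      ray-length + (k + ray-length)      ≤⟨ ℕ.+-monoʳ-≤ ray-length (ℕ.+-monoˡ-≤ ray-length k≤) ⟩
      ray-length + (N ∸ 1 + ray-length)  ≡⟨ solve 2 (λ m d → (con 1 :+ m :* d) :+ (m :+ (con 1 :+ m :* d))
                                                      := m :* (con 2 :* d :+ con 1) :+ con 2) refl (N ∸ 1) d ⟩
      bound                              ∎
      where
        open ℕ.≤-Reasoning
        open ℕ-Solver.+-*-Solver

    GoodWalk-to-orbit : ∀ x v → Σ V λ v′ → SameOrbit _~_ H v v′ ×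
                                Σ (List V) λ mid → GoodWalk x v′ mid × length mid < bound
    GoodWalk-to-orbit x v
      with a , up , length-up ← ascending-from ray-length x
      with b , down , length-down ← ascending-into ray-length v
      with t , b≈t , τ , τ-short ← orbit-distance connected a b
      with v′ , v≈v′ , down′ , same-length , _ ← relocate Up-invariant b≈t down
      with length-down′ ← trans same-length length-down
      with mid , good , length-mid
             ← GoodWalk-glue up τ down′ (link<ray τ-short length-up) (link<ray τ-short length-down′) =
      v′ , v≈v′ , mid , good , subst (_≤ bound) (sym length-mid) (rays-and-link≤bound τ-short length-up length-down′)

    Reach : V → V → ℕ → Set
    Reach x y n = WalkWith _~_ (λ mid v → SameOrbit _~_ H y v × Rising x v mid) n x

    reach? : ∀ x y → Decidable (Reach x y)
    reach? x y n = any-walk? _~_ ~-sym locally-finite n (λ mid v → same-orbit? y v ×-dec rising? x v mid) x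

    Covers : ℕ → Set
    Covers r = ∀ i j → i ≢ j → ∃ λ n → n < r × Reach (rep i) (rep j) n

    covers? : Decidable Covers
    covers? r = Fin.all? λ i → Fin.all? λ j → ¬? (i Fin.≟ j) →-dec ℕ.anyUpTo? (reach? (rep i) (rep j)) r

    covers-bound : Covers bound
    covers-bound i j _ with v′ , j≈v′ , mid , (walk , rising) , length< ← GoodWalk-to-orbit (rep i) (rep j) =
      length mid , length< , mid , v′ , walk , refl , j≈v′ , rising

    Covers⇒RProp : ∀ {r} → Covers r → RProp _~_ H h r
    Covers⇒RProp {r} covers u v u≉v
      with n , n<r , reach ← covers (orb u) (orb v) (u≉v ∘ orb-complete)
      with m , m≤n , (mid , v′ , walk , refl , rep≈v′ , rising) , shortest ← least (reach? _ _) reach =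
        rep (orb u) , v′ , orbit-sym (orb-rep u) , orbit-trans (orbit-sym (orb-rep v)) rep≈v′ , proj₁ rising
      , mid , walk
      , shortest-GoodWalk-Unique (walk , rising)
          (λ (walk′ , rising′) shorter → shortest shorter (_ , v′ , walk′ , refl , rep≈v′ , rising′))
      , subst (_≤ r) (ℕ.+-comm 1 (length mid)) (ℕ.≤-<-trans m≤n n<r)
      , proj₂ rising

    RProp⇒Covers : ∀ {r} → RProp _~_ H h r → Covers r
    RProp⇒Covers {r} rprop i j i≢j
      with u′ , v′ , i≈u′ , j≈v′ , u′<v′ , mid , walk , _ , length+1≤r , between
             ← rprop (rep i) (rep j) (i≢j ∘ rep-injective i j)
      with v″ , v′≈v″ , mid′ , (walk′ , rising′) , length≡
             ← GoodWalk-relocate (orbit-sym i≈u′) (walk , u′<v′ , between) =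
        length mid′
      , subst (λ l → suc l ≤ r) (sym length≡) (subst (_≤ r) (ℕ.+-comm (length mid) 1) length+1≤r)
      , mid′ , v″ , walk′ , refl , orbit-trans j≈v′ v′≈v″ , rising′

proposition3p2 : {V : Set} (_~_ : V → V → Set) (o : V)
    → IsSimple _~_ → InfiniteVertices _~_ → Connected _~_ → LocallyFinite _~_
    → QuasiTransitiveGraph _~_
    → (H : Subgroup _~_) (h : V → ℤ) → IsHeightFunction _~_ H o h
    → (N : ℕ) → NumOrbits _~_ H N
    → (d : ℕ) → IsD _~_ h d
    → Σ ℕ λ r → IsR _~_ H h r × r ≤ (N ∸ 1) * (2 * d + 1) + 2
proposition3p2 _~_ _ (~-sym , _) _ connected locally-finite _ H h (_ , _ , h-invariant , h-unbounded)
               N (rep , rep-injective , rep-covers) d (h-lipschitz , _) =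
  case transitive? of λ where
    (yes transitive) → 0 , inj₁ (transitive , refl) , z≤n
    (no intransitive) →
      let r , r≤bound , covers-r , below-r = least covers? covers-bound
          r-minimal r′ rprop-r′ = ℕ.≮⇒≥ λ r′<r → below-r r′<r (RProp⇒Covers rprop-r′)
      in r , inj₂ (intransitive , Covers⇒RProp covers-r , r-minimal) , r≤bound
  where
    open Orbits H rep rep-injective rep-covers using (transitive?)
    open Bound H ~-sym locally-finite connected rep rep-injective rep-covers h h-invariant h-unbounded d h-lipschitz
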